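{- Suppose that $W^{min}>C_1$, that $\mathcal{B}_\bullet$ is a $1$-feasible partition with $n_1(\mathcal{B}_1)\neq0$, and that $g_i(\mathcal{B}_\bullet)\geq w_1$ for some $i\geq2$. Then there exists a $1$-feasible partition $\mathcal{B}'_\bullet$ with $w(\mathcal{B}'_1)<w(\mathcal{B}_1)$.
   Context: Setting: integers $w_1\geq\cdots\geq w_n\geq0$, positive integer $d$, integers $C_1\geq\cdots\geq C_n$. $\mathcal{B}$ is the multiset with $d$ balls of weight $w_i$ for each $i$. A partition $\mathcal{B}_\bullet$ is $\mathcal{B}=\mathcal{B}_1\sqcup\cdots\sqcup\mathcal{B}_n$ with each $\mathcal{B}_i$ containing exactly $d$ balls; $w(\mathcal{B}_i)$ is its total weight, $g_i(\mathcal{B}_\bullet)=C_i-w(\mathcal{B}_i)$, and $n_1(\mathcal{B}_j)$ is the number of balls of weight $w_1$ in $\mathcal{B}_j$. The partition is $1$-feasible if $g_i(\mathcal{B}_\bullet)\geq0$ for $i=2,\dots,n$. Assuming $1$-feasible partitions exist, $W^{min}$ denotes the minimum of $w(\mathcal{B}_1)$ over all $1$-feasible partitions $\mathcal{B}_\bullet$. -}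

module Defs where

open import Data.Nat using (ℕ; zero; suc; _+_; _*_; _≥_)
open import Data.Nat.Properties using (_≟_)
open import Data.Fin using (Fin; zero; suc)
open import Data.Integer as ℤ using (ℤ; +_)
open import Data.Bool using (if_then_else_)
open import Relation.Nullary using (does)
open import Relation.Binary.PropositionalEquality using (_≡_)

sumFin : {n : ℕ} → (Fin n → ℕ) → ℕ
sumFin {zero}  f = 0
sumFin {suc n} f = f zero + sumFin (λ i → f (suc i))

-- Ball types are indexed by Fin n (type i has weight w i, d copies).
-- A partition B_• = B_1 ⊔ … ⊔ B_n of the multiset is recorded by
-- count j i = number of balls of type i placed in the part B_j.
record Partition (n d : ℕ) : Set where
  field
    count    : Fin n → Fin n → ℕ
    typeSum  : ∀ i → sumFin (λ j → count j i) ≡ d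
    partSize : ∀ j → sumFin (λ i → count j i) ≡ d
open Partition public

module _ {n d : ℕ} (w : Fin n → ℕ) where
  weight : Partition n d → Fin n → ℕ
  weight P j = sumFin (λ i → count P j i * w i)

gap : {n d : ℕ} → (w : Fin n → ℕ) → (C : Fin n → ℤ) → Partition n d → Fin n → ℤ
gap w C P i = C i ℤ.- (+ weight w P i)

n₁ : {m d : ℕ} → (w : Fin (suc m) → ℕ) → Partition (suc m) d → Fin (suc m) → ℕ
n₁ w P j = sumFin (λ i → if does (w i ≟ w zero) then count P j i else 0)

-- 1-feasible: g_i ≥ 0 for i = 2,…,n (i.e. all indices other than zero)
OneFeasible : {m d : ℕ} → (w : Fin (suc m) → ℕ) → (C : Fin (suc m) → ℤ) → Partition (suc m) d → Set
OneFeasible w C P = ∀ i → ℤ.+ 0 ℤ.≤ gap w C P (suc i)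

-- If B₁ holds a ball of weight w₁ and some part Bₚ (p ≥ 2) has slack gₚ ≥ w₁, two cases arise.
-- Either Bₚ holds a lighter ball, and exchanging it with that heaviest ball of B₁ lowers w(B₁)
-- while raising w(Bₚ) by less than w₁ and leaving every other part unchanged; or every ball of
-- Bₚ weighs w₁, and then C₁ < w(B₁) ≤ d w₁ = w(Bₚ) ≤ Cₚ - w₁ ≤ C₁, a contradiction.
module Submission where

open import Defs
open import Data.Nat using (ℕ; suc; _<_)
open import Data.Fin using (Fin; zero; suc; _≤_)
open import Data.Integer as ℤ using (ℤ; +_)
open import Data.Product using (Σ; ∃; _×_)
open import Relation.Binary.PropositionalEquality using (_≢_)

open import Data.Nat as ℕ using (zero; z≤n; s≤s; _∸_; _*_; _+_)
import Data.Nat.Properties as ℕ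
import Data.Integer.Properties as ℤ
import Data.Fin.Properties as Fin
open import Data.Product using (_,_)
open import Data.Bool using (if_then_else_)
open import Data.Empty using (⊥-elim)
open import Function using (_∘_)
open import Relation.Nullary using (Dec; yes; no; does)
open import Relation.Nullary.Decidable using (_×-dec_)
open import Algebra.Properties.CommutativeSemigroup ℕ.+-commutativeSemigroup
  using () renaming (interchange to +-interchange)
open import Relation.Binary.PropositionalEquality
  using (_≡_; refl; sym; trans; cong; cong₂; subst; subst₂; module ≡-Reasoning)

δ : ∀ {n} → Fin n → Fin n → ℕ
δ zero    zero    = 1
δ zero    (suc _) = 0
δ (suc _) zero    = 0
δ (suc a) (suc b) = δ a b

δ-refl : ∀ {n} (a : Fin n) → δ a a ≡ 1
δ-refl zero    = refl
δ-refl (suc a) = δ-refl a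

δ-≢ : ∀ {n} {a b : Fin n} → a ≢ b → δ a b ≡ 0
δ-≢ {a = zero}  {zero}  a≢b = ⊥-elim (a≢b refl)
δ-≢ {a = zero}  {suc b} a≢b = refl
δ-≢ {a = suc a} {zero}  a≢b = refl
δ-≢ {a = suc a} {suc b} a≢b = δ-≢ (a≢b ∘ cong suc)

sumFin-zero : ∀ {n} → sumFin {n} (λ _ → 0) ≡ 0
sumFin-zero {zero}  = refl
sumFin-zero {suc n} = sumFin-zero {n}

sumFin-cong : ∀ {n} {f g : Fin n → ℕ} → (∀ i → f i ≡ g i) → sumFin f ≡ sumFin g
sumFin-cong {zero}  f≗g = refl
sumFin-cong {suc n} f≗g = cong₂ _+_ (f≗g zero) (sumFin-cong (f≗g ∘ suc))

sumFin-+ : ∀ {n} (f g : Fin n → ℕ) → sumFin (λ i → f i + g i) ≡ sumFin f + sumFin g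
sumFin-+ {zero}  f g = refl
sumFin-+ {suc n} f g = begin
  (f zero + g zero) + sumFin (λ i → f (suc i) + g (suc i))
    ≡⟨ cong (_+_ (f zero + g zero)) (sumFin-+ (f ∘ suc) (g ∘ suc)) ⟩
  (f zero + g zero) + (sumFin (f ∘ suc) + sumFin (g ∘ suc))
    ≡⟨ +-interchange (f zero) (g zero) _ _ ⟩
  (f zero + sumFin (f ∘ suc)) + (g zero + sumFin (g ∘ suc)) ∎
  where open ≡-Reasoning

sumFin-*ˡ : ∀ {n} (c : ℕ) (f : Fin n → ℕ) → sumFin (λ i → c * f i) ≡ c * sumFin f
sumFin-*ˡ {zero}  c f = sym (ℕ.*-zeroʳ c)
sumFin-*ˡ {suc n} c f = trans (cong (_+_ (c * f zero)) (sumFin-*ˡ c (f ∘ suc)))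
  (sym (ℕ.*-distribˡ-+ c (f zero) (sumFin (f ∘ suc))))

sumFin-*ʳ : ∀ {n} (f : Fin n → ℕ) (c : ℕ) → sumFin (λ i → f i * c) ≡ sumFin f * c
sumFin-*ʳ f c = trans (sumFin-cong (λ i → ℕ.*-comm (f i) c))
  (trans (sumFin-*ˡ c f) (ℕ.*-comm c (sumFin f)))

sumFin-mono-≤ : ∀ {n} {f g : Fin n → ℕ} → (∀ i → f i ℕ.≤ g i) → sumFin f ℕ.≤ sumFin g
sumFin-mono-≤ {zero}  f≤g = z≤n
sumFin-mono-≤ {suc n} f≤g = ℕ.+-mono-≤ (f≤g zero) (sumFin-mono-≤ (f≤g ∘ suc))

sumFin≢0⇒∃≢0 : ∀ {n} (f : Fin n → ℕ) → sumFin f ≢ 0 → ∃ λ i → f i ≢ 0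
sumFin≢0⇒∃≢0 {zero}  f Σf≢0 = ⊥-elim (Σf≢0 refl)
sumFin≢0⇒∃≢0 {suc n} f Σf≢0 with f zero ℕ.≟ 0
... | no f0≢0 = zero , f0≢0
... | yes f0≡0 with sumFin≢0⇒∃≢0 (f ∘ suc) (Σf≢0 ∘ cong₂ _+_ f0≡0)
...   | i , fi≢0 = suc i , fi≢0

sumFin-δ : ∀ {n} (a : Fin n) (f : Fin n → ℕ) → sumFin (λ j → δ a j * f j) ≡ f a
sumFin-δ {suc n} zero f = begin
  (f zero + 0) + sumFin {n} (λ _ → 0) ≡⟨ cong (_+_ (f zero + 0)) (sumFin-zero {n}) ⟩
  (f zero + 0) + 0                    ≡⟨ ℕ.+-identityʳ _ ⟩
  f zero + 0                          ≡⟨ ℕ.+-identityʳ _ ⟩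
  f zero                              ∎
  where open ≡-Reasoning
sumFin-δ (suc a) f = sumFin-δ a (f ∘ suc)

sumFin-δ-+ : ∀ {n} (a b : Fin n) (u v : ℕ) → sumFin (λ j → δ a j * u + δ b j * v) ≡ u + v
sumFin-δ-+ a b u v = trans (sumFin-+ (λ j → δ a j * u) (λ j → δ b j * v))
  (cong₂ _+_ (sumFin-δ a (λ _ → u)) (sumFin-δ b (λ _ → v)))

sumFin-δ-pair : ∀ {n} (a b : Fin n) (u v : ℕ) (g : Fin n → ℕ) →
  sumFin (λ j → (u * δ a j + v * δ b j) * g j) ≡ u * g a + v * g b
sumFin-δ-pair a b u v g = begin
  sumFin (λ j → (u * δ a j + v * δ b j) * g j)
    ≡⟨ sumFin-cong expand ⟩
  sumFin (λ j → u * (δ a j * g j) + v * (δ b j * g j))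
    ≡⟨ sumFin-+ (λ j → u * (δ a j * g j)) (λ j → v * (δ b j * g j)) ⟩
  sumFin (λ j → u * (δ a j * g j)) + sumFin (λ j → v * (δ b j * g j))
    ≡⟨ cong₂ _+_ (sumFin-*ˡ u (λ j → δ a j * g j)) (sumFin-*ˡ v (λ j → δ b j * g j)) ⟩
  u * sumFin (λ j → δ a j * g j) + v * sumFin (λ j → δ b j * g j)
    ≡⟨ cong₂ (λ x y → u * x + v * y) (sumFin-δ a g) (sumFin-δ b g) ⟩
  u * g a + v * g b ∎
  where
  open ≡-Reasoning
  expand : ∀ j → (u * δ a j + v * δ b j) * g j ≡ u * (δ a j * g j) + v * (δ b j * g j)
  expand j = trans (ℕ.*-distribʳ-+ (g j) (u * δ a j) (v * δ b j))
    (cong₂ _+_ (ℕ.*-assoc u (δ a j) (g j)) (ℕ.*-assoc v (δ b j) (g j)))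

sumFin-balance : ∀ {n} {f f′ u v : Fin n → ℕ} → (∀ i → f′ i + u i ≡ f i + v i) →
  sumFin f′ + sumFin u ≡ sumFin f + sumFin v
sumFin-balance {f = f} {f′} {u} {v} eq =
  trans (sym (sumFin-+ f′ u)) (trans (sumFin-cong eq) (sumFin-+ f v))

δ*δ≤ : ∀ {n} (c : Fin n → Fin n → ℕ) {a k : Fin n} → 1 ℕ.≤ c a k → ∀ j y → δ a j * δ k y ℕ.≤ c j y
δ*δ≤ c {a} {k} 1≤cak j y with a Fin.≟ j | k Fin.≟ y
... | yes refl | yes refl rewrite δ-refl a | δ-refl k = 1≤cak
... | yes refl | no k≢y   rewrite δ-≢ k≢y | ℕ.*-zeroʳ (δ a a) = z≤n
... | no a≢j   | _        rewrite δ-≢ a≢j = z≤n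

-- Part a hands a ball of type k to part b and receives one of type t; the ∸ in count′ never
-- truncates, by outgoing≤count.
module Exchange {n d : ℕ} (P : Partition n d) {a b : Fin n} (a≢b : a ≢ b) {k t : Fin n}
                (1≤cak : 1 ℕ.≤ count P a k) (1≤cbt : 1 ℕ.≤ count P b t) where

  outgoing incoming : Fin n → Fin n → ℕ
  outgoing j y = δ a j * δ k y + δ b j * δ t y
  incoming j y = δ b j * δ k y + δ a j * δ t y

  count′ : Fin n → Fin n → ℕ
  count′ j y = count P j y + incoming j y ∸ outgoing j y

  outgoing≤count : ∀ j y → outgoing j y ℕ.≤ count P j y
  outgoing≤count j y with a Fin.≟ j
  ... | yes refl rewrite δ-≢ (a≢b ∘ sym) | ℕ.+-identityʳ (δ a a * δ k y) = δ*δ≤ (count P) 1≤cak a y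
  ... | no a≢j   rewrite δ-≢ a≢j = δ*δ≤ (count P) 1≤cbt j y

  count′-balance : ∀ j y → count′ j y + outgoing j y ≡ count P j y + incoming j y
  count′-balance j y = ℕ.m∸n+n≡m (ℕ.≤-trans (outgoing≤count j y) (ℕ.m≤m+n _ _))

  weighted-balance : ∀ j (g : Fin n → ℕ) →
    sumFin (λ y → count′ j y * g y) + (δ a j * g k + δ b j * g t)
      ≡ sumFin (λ y → count P j y * g y) + (δ b j * g k + δ a j * g t)
  weighted-balance j g = begin
    sumFin (λ y → count′ j y * g y) + (δ a j * g k + δ b j * g t)
      ≡⟨ cong (_+_ (sumFin (λ y → count′ j y * g y))) (sumFin-δ-pair k t (δ a j) (δ b j) g) ⟨
    sumFin (λ y → count′ j y * g y) + sumFin (λ y → outgoing j y * g y)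
      ≡⟨ sumFin-balance balance ⟩
    sumFin (λ y → count P j y * g y) + sumFin (λ y → incoming j y * g y)
      ≡⟨ cong (_+_ (sumFin (λ y → count P j y * g y))) (sumFin-δ-pair k t (δ b j) (δ a j) g) ⟩
    sumFin (λ y → count P j y * g y) + (δ b j * g k + δ a j * g t) ∎
    where
    open ≡-Reasoning
    balance : ∀ y → count′ j y * g y + outgoing j y * g y ≡ count P j y * g y + incoming j y * g y
    balance y = trans (sym (ℕ.*-distribʳ-+ (g y) (count′ j y) (outgoing j y)))
      (trans (cong (_* g y) (count′-balance j y)) (ℕ.*-distribʳ-+ (g y) (count P j y) (incoming j y)))

  typeSum′ : ∀ y → sumFin (λ j → count′ j y) ≡ d
  typeSum′ y = trans (ℕ.+-cancelʳ-≡ _ _ _ moved) (typeSum P y)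
    where
    moved : sumFin (λ j → count′ j y) + (δ k y + δ t y) ≡ sumFin (λ j → count P j y) + (δ k y + δ t y)
    moved = begin
      sumFin (λ j → count′ j y) + (δ k y + δ t y)
        ≡⟨ cong (_+_ (sumFin (λ j → count′ j y))) (sumFin-δ-+ a b (δ k y) (δ t y)) ⟨
      sumFin (λ j → count′ j y) + sumFin (λ j → outgoing j y)
        ≡⟨ sumFin-balance (λ j → count′-balance j y) ⟩
      sumFin (λ j → count P j y) + sumFin (λ j → incoming j y)
        ≡⟨ cong (_+_ (sumFin (λ j → count P j y))) (sumFin-δ-+ b a (δ k y) (δ t y)) ⟩
      sumFin (λ j → count P j y) + (δ k y + δ t y) ∎
      where open ≡-Reasoning

  partSize′ : ∀ j → sumFin (λ y → count′ j y) ≡ d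
  partSize′ j = trans (ℕ.+-cancelʳ-≡ _ _ _ moved) (partSize P j)
    where
    unweighted : ∀ (f : Fin n → ℕ) → sumFin (λ y → f y * 1) ≡ sumFin f
    unweighted f = sumFin-cong (λ y → ℕ.*-identityʳ (f y))
    moved : sumFin (λ y → count′ j y) + (δ a j * 1 + δ b j * 1)
          ≡ sumFin (λ y → count P j y) + (δ a j * 1 + δ b j * 1)
    moved = begin
      sumFin (λ y → count′ j y) + (δ a j * 1 + δ b j * 1)
        ≡⟨ cong (_+ _) (unweighted (count′ j)) ⟨
      sumFin (λ y → count′ j y * 1) + (δ a j * 1 + δ b j * 1)
        ≡⟨ weighted-balance j (λ _ → 1) ⟩
      sumFin (λ y → count P j y * 1) + (δ b j * 1 + δ a j * 1)
        ≡⟨ cong₂ _+_ (unweighted (count P j)) (ℕ.+-comm (δ b j * 1) (δ a j * 1)) ⟩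
      sumFin (λ y → count P j y) + (δ a j * 1 + δ b j * 1) ∎
      where open ≡-Reasoning

  exchanged : Partition n d
  exchanged = record { count = count′ ; typeSum = typeSum′ ; partSize = partSize′ }

  module _ (w : Fin n → ℕ) where

    private
      weight-shift : ∀ j {u v} → δ a j * w k + δ b j * w t ≡ u → δ b j * w k + δ a j * w t ≡ v →
                     weight w exchanged j + u ≡ weight w P j + v
      weight-shift j refl refl = weighted-balance j w

      δ-pick : ∀ {x y : Fin n} → x ≢ y → ∀ u v → δ x x * u + δ y x * v ≡ u
      δ-pick {x} x≢y u v rewrite δ-refl x | δ-≢ (x≢y ∘ sym) = trans (ℕ.+-identityʳ _) (ℕ.+-identityʳ u)

      δ-pick′ : ∀ {x y : Fin n} → x ≢ y → ∀ u v → δ y x * u + δ x x * v ≡ v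
      δ-pick′ {x} x≢y u v rewrite δ-refl x | δ-≢ (x≢y ∘ sym) = ℕ.+-identityʳ v

      δ-vanish : ∀ {j x y : Fin n} → j ≢ x → j ≢ y → ∀ u v → δ x j * u + δ y j * v ≡ 0
      δ-vanish j≢x j≢y u v rewrite δ-≢ (j≢x ∘ sym) | δ-≢ (j≢y ∘ sym) = refl

    weight-exchanged-source : weight w exchanged a + w k ≡ weight w P a + w t
    weight-exchanged-source = weight-shift a (δ-pick a≢b (w k) (w t)) (δ-pick′ a≢b (w k) (w t))

    weight-exchanged-target : weight w exchanged b + w t ≡ weight w P b + w k
    weight-exchanged-target = weight-shift b (δ-pick′ (a≢b ∘ sym) (w k) (w t)) (δ-pick (a≢b ∘ sym) (w k) (w t))

    weight-exchanged-other : ∀ j → j ≢ a → j ≢ b → weight w exchanged j ≡ weight w P j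
    weight-exchanged-other j j≢a j≢b = ℕ.+-cancelʳ-≡ 0 _ _
      (weight-shift j (δ-vanish j≢a j≢b (w k) (w t)) (δ-vanish j≢b j≢a (w k) (w t)))

module _ {n d : ℕ} (w : Fin n → ℕ) (P : Partition n d) where

  sumFin-count*const : ∀ j x → sumFin (λ y → count P j y * x) ≡ d * x
  sumFin-count*const j x = trans (sumFin-*ʳ (count P j) x) (cong (_* x) (partSize P j))

  weight≤ : ∀ {x} j → (∀ y → w y ℕ.≤ x) → weight w P j ℕ.≤ d * x
  weight≤ {x} j w≤x = subst (weight w P j ℕ.≤_) (sumFin-count*const j x)
    (sumFin-mono-≤ (λ y → ℕ.*-monoʳ-≤ (count P j y) (w≤x y)))

  weight≥ : ∀ {x} j → (∀ y → 1 ℕ.≤ count P j y → x ℕ.≤ w y) → d * x ℕ.≤ weight w P j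
  weight≥ {x} j x≤w = subst (ℕ._≤ weight w P j) (sumFin-count*const j x) (sumFin-mono-≤ term≥)
    where
    term≥ : ∀ y → count P j y * x ℕ.≤ count P j y * w y
    term≥ y with count P j y in c≡
    ... | zero  = z≤n
    ... | suc c = ℕ.*-monoʳ-≤ (suc c) (x≤w y (subst (1 ℕ.≤_) (sym c≡) (s≤s z≤n)))

  lighter-ball : ∀ {x} j p → (∀ y → w y ℕ.≤ x) → weight w P p < weight w P j →
                 ∃ λ t → 1 ℕ.≤ count P p t × w t < x
  lighter-ball {x} j p w≤x Wp<Wj with Fin.any? (λ t → (1 ℕ.≤? count P p t) ×-dec (w t ℕ.<? x))
  ... | yes light = light
  ... | no ¬light = ⊥-elim (ℕ.<-irrefl refl (ℕ.<-≤-trans Wp<Wj Wj≤Wp))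
    where
    Wj≤Wp : weight w P j ℕ.≤ weight w P p
    Wj≤Wp = ℕ.≤-trans (weight≤ j w≤x) (weight≥ p (λ y 1≤c → ℕ.≮⇒≥ (λ wy<x → ¬light (y , 1≤c , wy<x))))

if-does-≢0 : ∀ {P : Set} (P? : Dec P) (x : ℕ) → (if does P? then x else 0) ≢ 0 → P × x ≢ 0
if-does-≢0 (yes p) x x≢0 = p , x≢0
if-does-≢0 (no _)  x 0≢0 = ⊥-elim (0≢0 refl)

heaviest-ball : ∀ {m d} (w : Fin (suc m) → ℕ) (P : Partition (suc m) d) j →
                n₁ w P j ≢ 0 → ∃ λ k → 1 ℕ.≤ count P j k × w k ≡ w zero
heaviest-ball w P j n₁≢0 with sumFin≢0⇒∃≢0 _ n₁≢0
... | k , term≢0 with if-does-≢0 (w k ℕ.≟ w zero) (count P j k) term≢0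
...   | wk≡w₁ , c≢0 = k , ℕ.n≢0⇒n>0 c≢0 , wk≡w₁

m+n≡o+p∧p<n⇒m<o : ∀ {m n o p} → m + n ≡ o + p → p < n → m < o
m+n≡o+p∧p<n⇒m<o {m} {n} {o} {p} eq p<n =
  ℕ.+-cancelʳ-< p m o (subst (m + p <_) eq (ℕ.+-monoʳ-< m p<n))

+m≤i-+n⇒+[n+m]≤i : ∀ {i} m n → + m ℤ.≤ i ℤ.- + n → + (n + m) ℤ.≤ i
+m≤i-+n⇒+[n+m]≤i {i} m n m≤i-n = subst₂ ℤ._≤_ (ℤ.+-comm (+ m) (+ n)) i-n+n≡i (ℤ.+-monoˡ-≤ (+ n) m≤i-n)
  where
  open ≡-Reasoning
  i-n+n≡i : i ℤ.- + n ℤ.+ + n ≡ i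
  i-n+n≡i = begin
    i ℤ.- + n ℤ.+ + n        ≡⟨ ℤ.+-assoc i (ℤ.- + n) (+ n) ⟩
    i ℤ.+ (ℤ.- + n ℤ.+ + n)  ≡⟨ cong (ℤ._+_ i) (ℤ.+-inverseˡ (+ n)) ⟩
    i ℤ.+ + 0                ≡⟨ ℤ.+-identityʳ i ⟩
    i                        ∎

exchange-lowers-first-weight :
  ∀ {m d} (w : Fin (suc m) → ℕ) (C : Fin (suc m) → ℤ) (B : Partition (suc m) d) → OneFeasible w C B →
  ∀ {k t} (i : Fin m) → 1 ℕ.≤ count B zero k → 1 ℕ.≤ count B (suc i) t → w t < w k →
  + (weight w B (suc i) + w k) ℤ.≤ C (suc i) →
  Σ (Partition (suc m) d) λ B′ → OneFeasible w C B′ × weight w B′ zero < weight w B zero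
exchange-lowers-first-weight w C B B-feasible {k} i 1≤c₁k 1≤cₚt wt<wk Wₚ+wk≤Cₚ =
  exchanged , feasible , m+n≡o+p∧p<n⇒m<o (weight-exchanged-source w) wt<wk
  where
  open Exchange B (λ ()) 1≤c₁k 1≤cₚt
  feasible : OneFeasible w C exchanged
  feasible j with i Fin.≟ j
  ... | yes refl = ℤ.i≤j⇒0≤j-i (ℤ.≤-trans (ℤ.+≤+ W′ₚ≤Wₚ+wk) Wₚ+wk≤Cₚ)
    where
    W′ₚ≤Wₚ+wk : weight w exchanged (suc i) ℕ.≤ weight w B (suc i) + w k
    W′ₚ≤Wₚ+wk = subst (weight w exchanged (suc i) ℕ.≤_) (weight-exchanged-target w) (ℕ.m≤m+n _ _)
  ... | no i≢j = subst (λ W → + 0 ℤ.≤ C (suc j) ℤ.- + W)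
    (sym (weight-exchanged-other w (suc j) (λ ()) (i≢j ∘ sym ∘ Fin.suc-injective))) (B-feasible j)

lemma2p5 : (m : ℕ) → (d : ℕ) → 1 Data.Nat.≤ d →
    (w : Fin (suc m) → ℕ) → (∀ i j → i ≤ j → w j Data.Nat.≤ w i) →
    (C : Fin (suc m) → ℤ) → (∀ i j → i ≤ j → C j ℤ.≤ C i) →
    -- W^min > C_1 : every 1-feasible partition has w(B_1) > C_1
    (∀ (P : Partition (suc m) d) → OneFeasible w C P → C zero ℤ.< + weight w P zero) →
    (B : Partition (suc m) d) → OneFeasible w C B →
    n₁ w B zero ≢ 0 →
    (∃ λ (i : Fin m) → + w zero ℤ.≤ gap w C B (suc i)) →
    Σ (Partition (suc m) d) λ B′ → OneFeasible w C B′ × weight w B′ zero < weight w B zero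
lemma2p5 m d _ w w-anti C C-anti Wmin>C₁ B B-feasible n₁≢0 (i , w₁≤gₚ) =
  let k , 1≤c₁k , wk≡w₁ = heaviest-ball w B zero n₁≢0
      t , 1≤cₚt , wt<w₁ = lighter-ball w B zero (suc i) (λ y → w-anti zero y z≤n) Wₚ<W₁
  in exchange-lowers-first-weight w C B B-feasible i 1≤c₁k 1≤cₚt
       (subst (w t <_) (sym wk≡w₁) wt<w₁) (subst (λ x → + (W (suc i) + x) ℤ.≤ C (suc i)) (sym wk≡w₁) Wₚ+w₁≤Cₚ)
  where
  W : Fin (suc m) → ℕ
  W = weight w B
  Wₚ+w₁≤Cₚ : + (W (suc i) + w zero) ℤ.≤ C (suc i)
  Wₚ+w₁≤Cₚ = +m≤i-+n⇒+[n+m]≤i (w zero) (W (suc i)) w₁≤gₚ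
  Wₚ<W₁ : W (suc i) < W zero
  Wₚ<W₁ = ℤ.drop‿+<+ (ℤ.≤-<-trans (ℤ.+≤+ (ℕ.m≤m+n (W (suc i)) (w zero)))
    (ℤ.≤-<-trans Wₚ+w₁≤Cₚ (ℤ.≤-<-trans (C-anti zero (suc i) z≤n) (Wmin>C₁ B B-feasible))))
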